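{- Let $N \ge 1$, let $G_N$ be the divisibility graph on $X_N=\{1,\dots,N\}$, and let $n \in X_N$. Let $s(m)$ denote the number of positive divisors of $m$ (including $1$ and $m$), and put $M(n)=\left\lfloor \frac{N}{n}\right\rfloor$. Let $e_n$ be the number of unordered pairs $\{i,j\}$ of distinct neighbours of $n$ in $G_N$ such that $i$ and $j$ are adjacent. Then $$e_n = \sum_{m \mid n} s(m) - 2s(n) + 1 + \sum_{j=2}^{M(n)} \left\lfloor \frac{M(n)}{j} \right\rfloor + (M(n)-1)\,(s(n)-2),$$ where the first sum runs over the positive divisors $m$ of $n$.
   Context: The divisibility graph $G_N$ is the simple undirected graph with vertex set $X_N=\{1,\dots,N\}$, in which two distinct vertices $i \ne j$ are adjacent if and only if $i$ divides $j$ or $j$ divides $i$ (no loops). Two vertices are neighbours if they are adjacent. $\lfloor x \rfloor$ denotes the floor of $x$; an empty sum is $0$. -}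

module Defs where

open import Data.Nat using (ℕ; zero; suc; _<_; _<?_; _≟_)
open import Data.Nat.Divisibility using (_∣_; _∣?_)
open import Data.Nat.DivMod using (_/_)
open import Data.List using (List; []; _∷_; map; filter; length; upTo; concatMap)
open import Data.Nat.ListAction using (sum)
open import Data.Product using (_×_; _,_; proj₁; proj₂)
open import Data.Sum using (_⊎_)
open import Relation.Nullary using (¬_; ¬?)
open import Relation.Nullary.Decidable using (_×-dec_; _⊎-dec_)
open import Relation.Binary using (Decidable)

range : ℕ → List ℕ
range N = map suc (upTo N)

Adj : ℕ → ℕ → Set
Adj i j = ¬ (i ≡ j) × (i ∣ j ⊎ j ∣ i)
  where open import Relation.Binary.PropositionalEquality using (_≡_)

adj? : Decidable Adj
adj? i j = ¬? (i ≟ j) ×-dec (i ∣? j ⊎-dec j ∣? i)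

s : ℕ → ℕ
s m = length (filter (_∣? m) (range m))

sumDivS : ℕ → ℕ
sumDivS n = sum (map s (filter (_∣? n) (range n)))

-- floor division, with the (unused) convention a / 0 = 0
floorDiv : ℕ → ℕ → ℕ
floorDiv a zero = 0
floorDiv a (suc b) = a / suc b

-- sum_{j=2}^{M} floor(M / j)  (empty when M ≤ 1)
sumFloor : ℕ → ℕ
sumFloor M = sum (map (λ k → floorDiv M (suc k)) (range (M ∸ 1)))
  where open import Data.Nat using (_∸_)

-- all unordered pairs {i,j} of distinct vertices of G_N, encoded as (i,j) with i < j
pairs : ℕ → List (ℕ × ℕ)
pairs N = filter (λ p → proj₁ p <? proj₂ p)
                 (concatMap (λ i → map (λ j → (i , j)) (range N)) (range N))

Triangle : ℕ → ℕ × ℕ → Set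
Triangle n p = Adj n (proj₁ p) × Adj n (proj₂ p) × Adj (proj₁ p) (proj₂ p)

triangle? : (n : ℕ) → (p : ℕ × ℕ) → Relation.Nullary.Dec (Triangle n p)
triangle? n (i , j) = adj? n i ×-dec (adj? n j ×-dec adj? i j)

e : ℕ → ℕ → ℕ
e N n = length (filter (triangle? n) (pairs N))

-- Three pairwise comparable numbers form a divisibility chain, so exactly
-- one of i ∣ j ∣ n, i ∣ n ∣ j, n ∣ i ∣ j holds, all divisibilities proper.
-- Chains below n number Σ (s(d) − 1) over the proper divisors d of n, that is
-- Σ_{m ∣ n} s(m) − 2 s(n) + 1; chains through n number (s(n) − 1)(M − 1); and
-- chains above n number Σ_{k=2}^{M} (⌊M/k⌋ − 1), because the multiples of kn
-- in X_N are counted by ⌊N/(kn)⌋ = ⌊M/k⌋.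
module Submission where

open import Defs

module TriangleCount where

  open import Algebra.Properties.CommutativeSemigroup using (interchange)
  open import Data.Bool using (true; false; if_then_else_)
  open import Data.List using (List; []; _∷_; _++_; [_]; map; filter; length; upTo; concatMap)
  open import Data.List.Properties using (map-++; map-∘; upTo-∷ʳ)
  open import Data.Nat
    using (ℕ; zero; suc; _+_; _*_; _≤_; _<_; _≤′_; ≤′-reflexive; ≤′-step; z≤n; s≤s; _≟_; _<?_)
  open import Data.Nat.DivMod
    using (_/_; _%_; m≡m%n+[m/n]*n; m%n<n; n/1≡n; m/n/o≡m/[n*o]; m≥n⇒m/n>0)
  open import Data.Nat.Divisibility
    using (_∣_; _∣?_; ∣⇒≤; ∣-antisym; ∣-trans; ∣-refl; ∣m+n∣m⇒∣n; n∣m*n)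
  open import Data.Nat.ListAction using (sum)
  open import Data.Nat.ListAction.Properties using (sum-++)
  open import Data.Nat.Properties
  open import Data.Product using (_×_; _,_; proj₁; proj₂)
  open import Data.Sum using (_⊎_; inj₁; inj₂; [_,_]′)
  open import Function using (_∘_; id)
  open import Level using (Level)
  open import Relation.Binary.PropositionalEquality
    using (_≡_; _≢_; refl; sym; trans; cong; cong₂; subst; module ≡-Reasoning)
  open import Relation.Nullary using (Dec; yes; no; does; ¬_; ¬?; contradiction)
  open import Relation.Nullary.Decidable using (_×-dec_; _⊎-dec_)
  open import Relation.Unary using (Pred; Decidable)
  open ≡-Reasoning

  private
    variable
      ℓ : Level
      A : Set
      P Q R : Set ℓ

    +-interchange : ∀ a b c d → (a + b) + (c + d) ≡ (a + c) + (b + d)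
    +-interchange = interchange +-commutativeSemigroup

  𝟙 : Dec P → ℕ
  𝟙 P? = if does P? then 1 else 0

  𝟙-yes : (P? : Dec P) → P → 𝟙 P? ≡ 1
  𝟙-yes (yes _) _  = refl
  𝟙-yes (no ¬p) p = contradiction p ¬p

  𝟙-no : (P? : Dec P) → ¬ P → 𝟙 P? ≡ 0
  𝟙-no (yes p) ¬p = contradiction p ¬p
  𝟙-no (no _)  _  = refl

  𝟙-× : (P? : Dec P) (Q? : Dec Q) → 𝟙 (P? ×-dec Q?) ≡ 𝟙 P? * 𝟙 Q?
  𝟙-× (yes _) (yes _) = refl
  𝟙-× (yes _) (no _)  = refl
  𝟙-× (no _)  _       = refl

  𝟙-⇔ : (P? : Dec P) (Q? : Dec Q) → (P → Q) → (Q → P) → 𝟙 P? ≡ 𝟙 Q?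
  𝟙-⇔ P? (yes q) _ Q→P = 𝟙-yes P? (Q→P q)
  𝟙-⇔ P? (no ¬q) P→Q _ = 𝟙-no P? (¬q ∘ P→Q)

  𝟙-⊎ : (P? : Dec P) (Q? : Dec Q) (R? : Dec R) →
        (P → Q ⊎ R) → (Q ⊎ R → P) → (Q → ¬ R) → 𝟙 P? ≡ 𝟙 Q? + 𝟙 R?
  𝟙-⊎ P? (yes q) (yes r) _   _   Q→¬R = contradiction r (Q→¬R q)
  𝟙-⊎ P? (yes q) (no _)  _   Q⊎R→P _  = 𝟙-yes P? (Q⊎R→P (inj₁ q))
  𝟙-⊎ P? (no _)  (yes r) _   Q⊎R→P _  = 𝟙-yes P? (Q⊎R→P (inj₂ r))
  𝟙-⊎ P? (no ¬q) (no ¬r) P→Q⊎R _ _   = 𝟙-no P? λ p → [ ¬q , ¬r ]′ (P→Q⊎R p)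

  𝟙-≟-sym : ∀ a b → 𝟙 (a ≟ b) ≡ 𝟙 (b ≟ a)
  𝟙-≟-sym a b = 𝟙-⇔ (a ≟ b) (b ≟ a) sym sym

  ∑ : ℕ → (ℕ → ℕ) → ℕ
  ∑ zero    f = 0
  ∑ (suc N) f = ∑ N f + f (suc N)

  ∑-cong : ∀ N {f g : ℕ → ℕ} → (∀ i → 1 ≤ i → i ≤ N → f i ≡ g i) → ∑ N f ≡ ∑ N g
  ∑-cong zero    _   = refl
  ∑-cong (suc N) f≗g = cong₂ _+_
    (∑-cong N λ i 1≤i i≤N → f≗g i 1≤i (m≤n⇒m≤1+n i≤N))
    (f≗g (suc N) (s≤s z≤n) ≤-refl)

  ∑-+ : ∀ N (f g : ℕ → ℕ) → ∑ N (λ i → f i + g i) ≡ ∑ N f + ∑ N g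
  ∑-+ zero    f g = refl
  ∑-+ (suc N) f g = trans (cong (_+ (f (suc N) + g (suc N))) (∑-+ N f g))
                          (+-interchange (∑ N f) (∑ N g) (f (suc N)) (g (suc N)))

  ∑-+₃ : ∀ N (f g h : ℕ → ℕ) → ∑ N (λ i → f i + g i + h i) ≡ ∑ N f + ∑ N g + ∑ N h
  ∑-+₃ N f g h = trans (∑-+ N _ h) (cong (_+ ∑ N h) (∑-+ N f g))

  ∑-distribˡ : ∀ N c (f : ℕ → ℕ) → ∑ N (λ i → c * f i) ≡ c * ∑ N f
  ∑-distribˡ zero    c f = sym (*-zeroʳ c)
  ∑-distribˡ (suc N) c f = trans (cong (_+ c * f (suc N)) (∑-distribˡ N c f))
                                 (sym (*-distribˡ-+ c (∑ N f) (f (suc N))))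

  ∑-distribʳ : ∀ N c (f : ℕ → ℕ) → ∑ N (λ i → f i * c) ≡ ∑ N f * c
  ∑-distribʳ zero    c f = refl
  ∑-distribʳ (suc N) c f = trans (cong (_+ f (suc N) * c) (∑-distribʳ N c f))
                                 (sym (*-distribʳ-+ c (∑ N f) (f (suc N))))

  ∑-const-1 : ∀ N → ∑ N (λ _ → 1) ≡ N
  ∑-const-1 zero    = refl
  ∑-const-1 (suc N) = trans (cong (_+ 1) (∑-const-1 N)) (+-comm N 1)

  ∑-head : ∀ N (f : ℕ → ℕ) → ∑ (suc N) f ≡ f 1 + ∑ N (f ∘ suc)
  ∑-head zero    f = sym (+-identityʳ (f 1))
  ∑-head (suc N) f = trans (cong (_+ f (suc (suc N))) (∑-head N f)) (+-assoc (f 1) _ _)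

  ∑-split : ∀ b a (f : ℕ → ℕ) → ∑ (b + a) f ≡ ∑ a f + ∑ b (λ i → f (i + a))
  ∑-split zero    a f = sym (+-identityʳ _)
  ∑-split (suc b) a f = trans (cong (_+ f (suc b + a)) (∑-split b a f)) (+-assoc (∑ a f) _ _)

  ∑-truncate : ∀ {m N} (f : ℕ → ℕ) → m ≤ N →
               (∀ i → m < i → i ≤ N → f i ≡ 0) → ∑ N f ≡ ∑ m f
  ∑-truncate {m} f = go ∘ ≤⇒≤′
    where
    go : ∀ {N} → m ≤′ N → (∀ i → m < i → i ≤ N → f i ≡ 0) → ∑ N f ≡ ∑ m f
    go (≤′-reflexive refl) _ = refl
    go (≤′-step m≤′N) f≡0 = trans
      (cong₂ _+_ (go m≤′N λ i m<i i≤N → f≡0 i m<i (m≤n⇒m≤1+n i≤N))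
                 (f≡0 _ (s≤s (≤′⇒≤ m≤′N)) ≤-refl))
      (+-identityʳ _)

  ∑-zero : ∀ N {f : ℕ → ℕ} → (∀ i → 1 ≤ i → i ≤ N → f i ≡ 0) → ∑ N f ≡ 0
  ∑-zero N {f} = ∑-truncate f z≤n

  ∑-swap : ∀ N K (f : ℕ → ℕ → ℕ) → ∑ N (λ i → ∑ K (f i)) ≡ ∑ K (λ j → ∑ N (λ i → f i j))
  ∑-swap zero    K f = sym (∑-zero K λ _ _ _ → refl)
  ∑-swap (suc N) K f = trans (cong (_+ ∑ K (f (suc N))) (∑-swap N K f))
                             (sym (∑-+ K _ (f (suc N))))

  ∑-delta : ∀ {a N} (f : ℕ → ℕ) → 1 ≤ a → a ≤ N → ∑ N (λ x → 𝟙 (x ≟ a) * f x) ≡ f a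
  ∑-delta {suc a} {N} f _ a≤N = begin
    ∑ N F
      ≡⟨ ∑-truncate F a≤N beyond ⟩
    ∑ a F + 𝟙 (suc a ≟ suc a) * f (suc a)
      ≡⟨ cong₂ _+_ (∑-zero a below) (cong (_* f (suc a)) (𝟙-yes (suc a ≟ suc a) refl)) ⟩
    0 + 1 * f (suc a)
      ≡⟨ +-identityʳ (f (suc a)) ⟩
    f (suc a)
      ∎
    where
    F : ℕ → ℕ
    F x = 𝟙 (x ≟ suc a) * f x
    beyond : ∀ i → suc a < i → i ≤ N → F i ≡ 0
    beyond i a<i _ = cong (_* f i) (𝟙-no (i ≟ suc a) λ i≡a → <-irrefl (sym i≡a) a<i)
    below : ∀ i → 1 ≤ i → i ≤ a → F i ≡ 0
    below i _ i≤a = cong (_* f i) (𝟙-no (i ≟ suc a) λ i≡a → <-irrefl i≡a (s≤s i≤a))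

  ∑-delta-sym : ∀ {a N} (f : ℕ → ℕ) → 1 ≤ a → a ≤ N → ∑ N (λ x → 𝟙 (a ≟ x) * f x) ≡ f a
  ∑-delta-sym {a} {N} f 1≤a a≤N =
    trans (∑-cong N λ x _ _ → cong (_* f x) (𝟙-≟-sym a x)) (∑-delta f 1≤a a≤N)

  ∑-𝟙-≟ : ∀ {a N} → 1 ≤ a → a ≤ N → ∑ N (λ x → 𝟙 (x ≟ a)) ≡ 1
  ∑-𝟙-≟ {a} {N} 1≤a a≤N =
    trans (∑-cong N λ x _ _ → sym (*-identityʳ _)) (∑-delta (λ _ → 1) 1≤a a≤N)

  length-filter : ∀ {P : Pred A ℓ} (P? : Decidable P) xs →
                  length (filter P? xs) ≡ sum (map (𝟙 ∘ P?) xs)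
  length-filter P? []       = refl
  length-filter P? (x ∷ xs) with does (P? x)
  ... | true  = cong suc (length-filter P? xs)
  ... | false = length-filter P? xs

  sum-map-filter : ∀ {P : Pred A ℓ} (P? : Decidable P) (f : A → ℕ) xs →
                   sum (map f (filter P? xs)) ≡ sum (map (λ x → 𝟙 (P? x) * f x) xs)
  sum-map-filter P? f []       = refl
  sum-map-filter P? f (x ∷ xs) with does (P? x)
  ... | true  = cong₂ _+_ (sym (+-identityʳ (f x))) (sum-map-filter P? f xs)
  ... | false = sum-map-filter P? f xs

  sum-map-concatMap : ∀ {B : Set} (g : A → List B) (f : B → ℕ) xs →
                      sum (map f (concatMap g xs)) ≡ sum (map (λ x → sum (map f (g x))) xs)
  sum-map-concatMap g f []       = refl
  sum-map-concatMap g f (x ∷ xs) = begin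
    sum (map f (g x ++ concatMap g xs))              ≡⟨ cong sum (map-++ f (g x) _) ⟩
    sum (map f (g x) ++ map f (concatMap g xs))      ≡⟨ sum-++ (map f (g x)) _ ⟩
    sum (map f (g x)) + sum (map f (concatMap g xs))
      ≡⟨ cong (sum (map f (g x)) +_) (sum-map-concatMap g f xs) ⟩
    sum (map f (g x)) + sum (map (λ y → sum (map f (g y))) xs) ∎

  sum-map-range : ∀ N (f : ℕ → ℕ) → sum (map f (range N)) ≡ ∑ N f
  sum-map-range zero    f = refl
  sum-map-range (suc N) f = begin
    sum (map f (map suc (upTo (suc N))))     ≡⟨ cong (sum ∘ map f ∘ map suc) (sym (upTo-∷ʳ N)) ⟩
    sum (map f (map suc (upTo N ++ [ N ])))  ≡⟨ cong (sum ∘ map f) (map-++ suc (upTo N) [ N ]) ⟩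
    sum (map f (range N ++ [ suc N ]))       ≡⟨ cong sum (map-++ f (range N) [ suc N ]) ⟩
    sum (map f (range N) ++ [ f (suc N) ])   ≡⟨ sum-++ (map f (range N)) [ f (suc N) ] ⟩
    sum (map f (range N)) + (f (suc N) + 0)  ≡⟨ cong₂ _+_ (sum-map-range N f) (+-identityʳ (f (suc N))) ⟩
    ∑ N f + f (suc N)                        ∎

  ∑-multiples : ∀ n (g : ℕ → ℕ) N →
                ∑ N (λ i → 𝟙 (suc n ∣? i) * g i) ≡ ∑ (N / suc n) (λ k → g (k * suc n))
  ∑-multiples n g N = begin
    ∑ N F                                        ≡⟨ cong (λ x → ∑ x F) (m≡m%n+[m/n]*n N (suc n)) ⟩
    ∑ (N % suc n + q * suc n) F                  ≡⟨ ∑-split (N % suc n) (q * suc n) F ⟩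
    ∑ (q * suc n) F + ∑ (N % suc n) (shifted q)
      ≡⟨ cong₂ _+_ (multiplesUpTo q) (∑-zero _ (nonMultiples q (m%n<n N (suc n)))) ⟩
    ∑ q (λ k → g (k * suc n)) + 0                ≡⟨ +-identityʳ _ ⟩
    ∑ q (λ k → g (k * suc n))                    ∎
    where
    q : ℕ
    q = N / suc n
    F : ℕ → ℕ
    F i = 𝟙 (suc n ∣? i) * g i
    shifted : ℕ → ℕ → ℕ
    shifted k i = F (i + k * suc n)
    nonMultiples : ∀ k {m} → m < suc n → ∀ i → 1 ≤ i → i ≤ m → shifted k i ≡ 0
    nonMultiples k m<n (suc i) _ i≤m = cong (_* g (suc i + k * suc n)) (𝟙-no (suc n ∣? _) λ n∣ →
      <⇒≱ (≤-<-trans i≤m m<n)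
          (∣⇒≤ (∣m+n∣m⇒∣n (subst (suc n ∣_) (+-comm (suc i) (k * suc n)) n∣) (n∣m*n k))))
    multiplesUpTo : ∀ k → ∑ (k * suc n) F ≡ ∑ k (λ k → g (k * suc n))
    multiplesUpTo zero    = refl
    multiplesUpTo (suc k) = begin
      ∑ (suc n + k * suc n) F                                  ≡⟨ ∑-split (suc n) (k * suc n) F ⟩
      ∑ (k * suc n) F + (∑ n (shifted k) + F (suc k * suc n))
        ≡⟨ cong₂ _+_ (multiplesUpTo k)
                     (cong₂ _+_ (∑-zero n (nonMultiples k ≤-refl))
                                (cong (_* g (suc k * suc n)) (𝟙-yes (suc n ∣? _) (n∣m*n (suc k))))) ⟩
      ∑ k (λ k → g (k * suc n)) + (0 + (g (suc k * suc n) + 0))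
        ≡⟨ cong (∑ k (λ k → g (k * suc n)) +_) (+-identityʳ _) ⟩
      ∑ (suc k) (λ k → g (k * suc n))                          ∎

  infix 4 _∣ₚ_ _∣ₚ?_

  _∣ₚ_ : ℕ → ℕ → Set
  a ∣ₚ b = a ∣ b × a ≢ b

  _∣ₚ?_ : ∀ a b → Dec (a ∣ₚ b)
  a ∣ₚ? b = a ∣? b ×-dec ¬? (a ≟ b)

  ⟦_∣ₚ_⟧ : ℕ → ℕ → ℕ
  ⟦ a ∣ₚ b ⟧ = 𝟙 (a ∣ₚ? b)

  ∣ₚ-asym : ∀ {a b} → a ∣ₚ b → ¬ b ∣ a
  ∣ₚ-asym (a∣b , a≢b) b∣a = a≢b (∣-antisym a∣b b∣a)

  ∣ₚ-trans : ∀ {a b c} → a ∣ₚ b → b ∣ₚ c → a ∣ₚ c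
  ∣ₚ-trans (a∣b , _) b∣ₚc@(b∣c , _) = ∣-trans a∣b b∣c , λ { refl → ∣ₚ-asym b∣ₚc a∣b }

  ∣⇒≤⁺ : ∀ {a b} → 1 ≤ b → a ∣ b → a ≤ b
  ∣⇒≤⁺ {b = suc _} _ = ∣⇒≤

  ∣ₚ⇒< : ∀ {a b} → 1 ≤ b → a ∣ₚ b → a < b
  ∣ₚ⇒< 1≤b (a∣b , a≢b) = ≤∧≢⇒< (∣⇒≤⁺ 1≤b a∣b) a≢b

  𝟙-∣-split : ∀ a b → 𝟙 (a ∣? b) ≡ ⟦ a ∣ₚ b ⟧ + 𝟙 (a ≟ b)
  𝟙-∣-split a b = 𝟙-⊎ (a ∣? b) (a ∣ₚ? b) (a ≟ b) properOrEqual
    [ proj₁ , (λ { refl → ∣-refl }) ]′ proj₂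
    where
    properOrEqual : a ∣ b → a ∣ₚ b ⊎ a ≡ b
    properOrEqual a∣b with a ≟ b
    ... | yes a≡b = inj₂ a≡b
    ... | no  a≢b = inj₁ (a∣b , a≢b)

  𝟙-∣-*-split : ∀ a b {w c} → w ≡ suc c →
                𝟙 (a ∣? b) * w ≡ ⟦ a ∣ₚ b ⟧ + ⟦ a ∣ₚ b ⟧ * c + 𝟙 (a ≟ b) * w
  𝟙-∣-*-split a b {c = c} refl = begin
    𝟙 (a ∣? b) * suc c                              ≡⟨ cong (_* suc c) (𝟙-∣-split a b) ⟩
    (⟦ a ∣ₚ b ⟧ + 𝟙 (a ≟ b)) * suc c                ≡⟨ *-distribʳ-+ (suc c) ⟦ a ∣ₚ b ⟧ _ ⟩
    ⟦ a ∣ₚ b ⟧ * suc c + 𝟙 (a ≟ b) * suc c          ≡⟨ cong (_+ 𝟙 (a ≟ b) * suc c) (*-suc ⟦ a ∣ₚ b ⟧ c) ⟩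
    ⟦ a ∣ₚ b ⟧ + ⟦ a ∣ₚ b ⟧ * c + 𝟙 (a ≟ b) * suc c  ∎

  properDivisorCount properMultipleCount : ℕ → ℕ → ℕ
  properDivisorCount  N m = ∑ N λ i → ⟦ i ∣ₚ m ⟧
  properMultipleCount N m = ∑ N λ j → ⟦ m ∣ₚ j ⟧

  s≡1+properDivisorCount : ∀ {m N} → 1 ≤ m → m ≤ N → s m ≡ suc (properDivisorCount N m)
  s≡1+properDivisorCount {m} {N} 1≤m m≤N = begin
    length (filter (_∣? m) (range m))                ≡⟨ length-filter (_∣? m) (range m) ⟩
    sum (map (λ i → 𝟙 (i ∣? m)) (range m))            ≡⟨ sum-map-range m _ ⟩
    ∑ m (λ i → 𝟙 (i ∣? m))                            ≡⟨ ∑-truncate _ m≤N nonDivisors ⟨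
    ∑ N (λ i → 𝟙 (i ∣? m))                            ≡⟨ ∑-cong N (λ i _ _ → 𝟙-∣-split i m) ⟩
    ∑ N (λ i → ⟦ i ∣ₚ m ⟧ + 𝟙 (i ≟ m))                 ≡⟨ ∑-+ N _ _ ⟩
    properDivisorCount N m + ∑ N (λ i → 𝟙 (i ≟ m))    ≡⟨ cong (properDivisorCount N m +_) (∑-𝟙-≟ 1≤m m≤N) ⟩
    properDivisorCount N m + 1                        ≡⟨ +-comm _ 1 ⟩
    suc (properDivisorCount N m)                      ∎
    where
    nonDivisors : ∀ i → m < i → i ≤ N → 𝟙 (i ∣? m) ≡ 0
    nonDivisors i m<i _ = 𝟙-no (i ∣? m) λ i∣m → <⇒≱ m<i (∣⇒≤⁺ 1≤m i∣m)

  /≡1+properMultipleCount : ∀ {N} a → suc a ≤ N →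
                            N / suc a ≡ suc (properMultipleCount N (suc a))
  /≡1+properMultipleCount {N} a a<N = begin
    N / suc a                                            ≡⟨ ∑-const-1 (N / suc a) ⟨
    ∑ (N / suc a) (λ _ → 1)                              ≡⟨ ∑-multiples a (λ _ → 1) N ⟨
    ∑ N (λ j → 𝟙 (suc a ∣? j) * 1)                       ≡⟨ ∑-cong N (λ j _ _ → split j) ⟩
    ∑ N (λ j → ⟦ suc a ∣ₚ j ⟧ + 𝟙 (j ≟ suc a))            ≡⟨ ∑-+ N _ _ ⟩
    properMultipleCount N (suc a) + ∑ N (λ j → 𝟙 (j ≟ suc a))
      ≡⟨ cong (properMultipleCount N (suc a) +_) (∑-𝟙-≟ (s≤s z≤n) a<N) ⟩
    properMultipleCount N (suc a) + 1                    ≡⟨ +-comm _ 1 ⟩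
    suc (properMultipleCount N (suc a))                  ∎
    where
    split : ∀ j → 𝟙 (suc a ∣? j) * 1 ≡ ⟦ suc a ∣ₚ j ⟧ + 𝟙 (j ≟ suc a)
    split j = trans (*-identityʳ _)
                    (trans (𝟙-∣-split (suc a) j) (cong (⟦ suc a ∣ₚ j ⟧ +_) (𝟙-≟-sym (suc a) j)))

  floorDiv≡1+properMultipleCount : ∀ {m N} → 1 ≤ m → m ≤ N →
                                   floorDiv N m ≡ suc (properMultipleCount N m)
  floorDiv≡1+properMultipleCount {suc a} _ = /≡1+properMultipleCount a

  floorDiv-/ : ∀ N n k → floorDiv (N / suc n) (suc k) ≡ floorDiv N (suc k * suc n)
  floorDiv-/ N n k = trans (m/n/o≡m/[n*o] N (suc n) (suc k))
                           (cong (floorDiv N) (*-comm (suc n) (suc k)))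

  ∑-floorDiv : ∀ M → 1 ≤ M → ∑ M (floorDiv M) ≡ M + sumFloor M
  ∑-floorDiv (suc M) _ = trans (∑-head M (floorDiv (suc M)))
    (cong₂ _+_ (n/1≡n (suc M)) (sym (sum-map-range M _)))

  Adj-sym : ∀ {a b} → Adj a b → Adj b a
  Adj-sym (a≢b , a∣b⊎b∣a) = a≢b ∘ sym , [ inj₂ , inj₁ ]′ a∣b⊎b∣a

  ∣ₚ⇒Adj : ∀ {a b} → a ∣ₚ b → Adj a b
  ∣ₚ⇒Adj (a∣b , a≢b) = a≢b , inj₁ a∣b

  Adj⇒∣ₚ : ∀ {a b} → Adj a b → a ∣ₚ b ⊎ b ∣ₚ a
  Adj⇒∣ₚ (a≢b , inj₁ a∣b) = inj₁ (a∣b , a≢b)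
  Adj⇒∣ₚ (a≢b , inj₂ b∣a) = inj₂ (b∣a , a≢b ∘ sym)

  Chain : ℕ → ℕ → ℕ → Set
  Chain a b c = a ∣ₚ b × b ∣ₚ c

  chain? : ∀ a b c → Dec (Chain a b c)
  chain? a b c = a ∣ₚ? b ×-dec b ∣ₚ? c

  module _ (n i j : ℕ) where

    OrderedTriangle OrderedChain : Set
    OrderedTriangle = i < j × Triangle n (i , j)
    OrderedChain    = (Chain i j n ⊎ Chain i n j) ⊎ Chain n i j

    orderedTriangle⇒chain : 1 ≤ i → OrderedTriangle → OrderedChain
    orderedTriangle⇒chain 1≤i (i<j , n~i , n~j , i~j)
      with Adj⇒∣ₚ i~j | Adj⇒∣ₚ n~i | Adj⇒∣ₚ n~j
    ... | inj₂ j∣ₚi | _         | _         = contradiction (∣ₚ⇒< 1≤i j∣ₚi) (<-asym i<j)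
    ... | inj₁ i∣ₚj | inj₁ n∣ₚi | _         = inj₂ (n∣ₚi , i∣ₚj)
    ... | inj₁ i∣ₚj | inj₂ i∣ₚn | inj₁ n∣ₚj = inj₁ (inj₂ (i∣ₚn , n∣ₚj))
    ... | inj₁ i∣ₚj | inj₂ i∣ₚn | inj₂ j∣ₚn = inj₁ (inj₁ (i∣ₚj , j∣ₚn))

    chain⇒orderedTriangle : 1 ≤ n → 1 ≤ j → OrderedChain → OrderedTriangle
    chain⇒orderedTriangle _ 1≤j (inj₁ (inj₁ (i∣ₚj , j∣ₚn))) =
      ∣ₚ⇒< 1≤j i∣ₚj ,
      Adj-sym (∣ₚ⇒Adj (∣ₚ-trans i∣ₚj j∣ₚn)) , Adj-sym (∣ₚ⇒Adj j∣ₚn) , ∣ₚ⇒Adj i∣ₚj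
    chain⇒orderedTriangle 1≤n 1≤j (inj₁ (inj₂ (i∣ₚn , n∣ₚj))) =
      <-trans (∣ₚ⇒< 1≤n i∣ₚn) (∣ₚ⇒< 1≤j n∣ₚj) ,
      Adj-sym (∣ₚ⇒Adj i∣ₚn) , ∣ₚ⇒Adj n∣ₚj , ∣ₚ⇒Adj (∣ₚ-trans i∣ₚn n∣ₚj)
    chain⇒orderedTriangle _ 1≤j (inj₂ (n∣ₚi , i∣ₚj)) =
      ∣ₚ⇒< 1≤j i∣ₚj ,
      ∣ₚ⇒Adj n∣ₚi , ∣ₚ⇒Adj (∣ₚ-trans n∣ₚi i∣ₚj) , ∣ₚ⇒Adj i∣ₚj

    chain-below⇒¬through : Chain i j n → ¬ Chain i n j
    chain-below⇒¬through (_ , j∣ₚn) (_ , (n∣j , _)) = ∣ₚ-asym j∣ₚn n∣j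

    chain-below-or-through⇒¬above : Chain i j n ⊎ Chain i n j → ¬ Chain n i j
    chain-below-or-through⇒¬above (inj₁ (i∣ₚj , j∣ₚn)) (n∣ₚi , _) =
      ∣ₚ-asym n∣ₚi (proj₁ (∣ₚ-trans i∣ₚj j∣ₚn))
    chain-below-or-through⇒¬above (inj₂ ((i∣n , _) , _)) (n∣ₚi , _) = ∣ₚ-asym n∣ₚi i∣n

    𝟙-orderedTriangle : 1 ≤ n → 1 ≤ i → 1 ≤ j →
      𝟙 (i <? j) * 𝟙 (triangle? n (i , j)) ≡ 𝟙 (chain? i j n) + 𝟙 (chain? i n j) + 𝟙 (chain? n i j)
    𝟙-orderedTriangle 1≤n 1≤i 1≤j = begin
      𝟙 (i <? j) * 𝟙 (triangle? n (i , j))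
        ≡⟨ 𝟙-× (i <? j) (triangle? n (i , j)) ⟨
      𝟙 (i <? j ×-dec triangle? n (i , j))
        ≡⟨ 𝟙-⊎ (i <? j ×-dec triangle? n (i , j)) (chain? i j n ⊎-dec chain? i n j) (chain? n i j)
               (orderedTriangle⇒chain 1≤i) (chain⇒orderedTriangle 1≤n 1≤j)
               chain-below-or-through⇒¬above ⟩
      𝟙 (chain? i j n ⊎-dec chain? i n j) + 𝟙 (chain? n i j)
        ≡⟨ cong (_+ 𝟙 (chain? n i j))
                (𝟙-⊎ (chain? i j n ⊎-dec chain? i n j) (chain? i j n) (chain? i n j)
                     id id chain-below⇒¬through) ⟩
      𝟙 (chain? i j n) + 𝟙 (chain? i n j) + 𝟙 (chain? n i j)
        ∎

  e≡∑∑ : ∀ N n → e N n ≡ ∑ N λ i → ∑ N λ j → 𝟙 (i <? j) * 𝟙 (triangle? n (i , j))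
  e≡∑∑ N n = begin
    length (filter (triangle? n) (filter ordered? grid))
      ≡⟨ length-filter (triangle? n) (filter ordered? grid) ⟩
    sum (map (𝟙 ∘ triangle? n) (filter ordered? grid))
      ≡⟨ sum-map-filter ordered? (𝟙 ∘ triangle? n) grid ⟩
    sum (map f grid)
      ≡⟨ sum-map-concatMap row f (range N) ⟩
    sum (map (λ i → sum (map f (row i))) (range N))
      ≡⟨ sum-map-range N _ ⟩
    ∑ N (λ i → sum (map f (row i)))
      ≡⟨ ∑-cong N (λ i _ _ → trans (cong sum (sym (map-∘ (range N)))) (sum-map-range N _)) ⟩
    ∑ N (λ i → ∑ N λ j → f (i , j))
      ∎
    where
    ordered? : ∀ (p : ℕ × ℕ) → Dec (proj₁ p < proj₂ p)
    ordered? p = proj₁ p <? proj₂ p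
    row : ℕ → List (ℕ × ℕ)
    row i = map (i ,_) (range N)
    grid : List (ℕ × ℕ)
    grid = concatMap row (range N)
    f : ℕ × ℕ → ℕ
    f p = 𝟙 (ordered? p) * 𝟙 (triangle? n p)

  chainsBelow chainsThrough chainsAbove : ℕ → ℕ → ℕ
  chainsBelow   N n = ∑ N λ i → ∑ N λ j → 𝟙 (chain? i j n)
  chainsThrough N n = ∑ N λ i → ∑ N λ j → 𝟙 (chain? i n j)
  chainsAbove   N n = ∑ N λ i → ∑ N λ j → 𝟙 (chain? n i j)

  e≡chains : ∀ N n → 1 ≤ n → e N n ≡ chainsBelow N n + chainsThrough N n + chainsAbove N n
  e≡chains N n 1≤n = begin
    e N n                                             ≡⟨ e≡∑∑ N n ⟩
    ∑ N (λ i → ∑ N λ j → 𝟙 (i <? j) * 𝟙 (triangle? n (i , j)))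
      ≡⟨ ∑-cong N (λ i 1≤i _ → ∑-cong N λ j 1≤j _ → 𝟙-orderedTriangle n i j 1≤n 1≤i 1≤j) ⟩
    ∑ N (λ i → ∑ N λ j → 𝟙 (chain? i j n) + 𝟙 (chain? i n j) + 𝟙 (chain? n i j))
      ≡⟨ ∑-cong N (λ i _ _ → ∑-+₃ N _ _ _) ⟩
    ∑ N (λ i → ∑ N (λ j → 𝟙 (chain? i j n)) + ∑ N (λ j → 𝟙 (chain? i n j))
                                             + ∑ N (λ j → 𝟙 (chain? n i j)))
      ≡⟨ ∑-+₃ N _ _ _ ⟩
    chainsBelow N n + chainsThrough N n + chainsAbove N n ∎

  chainsThrough≡ : ∀ N n → chainsThrough N n ≡ properDivisorCount N n * properMultipleCount N n
  chainsThrough≡ N n = begin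
    ∑ N (λ i → ∑ N λ j → 𝟙 (chain? i n j))
      ≡⟨ ∑-cong N (λ i _ _ → ∑-cong N λ j _ _ → 𝟙-× (i ∣ₚ? n) (n ∣ₚ? j)) ⟩
    ∑ N (λ i → ∑ N λ j → ⟦ i ∣ₚ n ⟧ * ⟦ n ∣ₚ j ⟧)     ≡⟨ ∑-cong N (λ i _ _ → ∑-distribˡ N ⟦ i ∣ₚ n ⟧ _) ⟩
    ∑ N (λ i → ⟦ i ∣ₚ n ⟧ * properMultipleCount N n)  ≡⟨ ∑-distribʳ N _ _ ⟩
    properDivisorCount N n * properMultipleCount N n  ∎

  chainsBelow≡ : ∀ N n → chainsBelow N n ≡ ∑ N λ j → ⟦ j ∣ₚ n ⟧ * properDivisorCount N j
  chainsBelow≡ N n = begin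
    ∑ N (λ i → ∑ N λ j → 𝟙 (chain? i j n))
      ≡⟨ ∑-cong N (λ i _ _ → ∑-cong N λ j _ _ → 𝟙-× (i ∣ₚ? j) (j ∣ₚ? n)) ⟩
    ∑ N (λ i → ∑ N λ j → ⟦ i ∣ₚ j ⟧ * ⟦ j ∣ₚ n ⟧)    ≡⟨ ∑-swap N N _ ⟩
    ∑ N (λ j → ∑ N λ i → ⟦ i ∣ₚ j ⟧ * ⟦ j ∣ₚ n ⟧)    ≡⟨ ∑-cong N (λ j _ _ → ∑-distribʳ N ⟦ j ∣ₚ n ⟧ _) ⟩
    ∑ N (λ j → properDivisorCount N j * ⟦ j ∣ₚ n ⟧)  ≡⟨ ∑-cong N (λ j _ _ → *-comm _ ⟦ j ∣ₚ n ⟧) ⟩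
    ∑ N (λ j → ⟦ j ∣ₚ n ⟧ * properDivisorCount N j)  ∎

  chainsAbove≡ : ∀ N n → chainsAbove N n ≡ ∑ N λ i → ⟦ n ∣ₚ i ⟧ * properMultipleCount N i
  chainsAbove≡ N n = ∑-cong N λ i _ _ →
    trans (∑-cong N λ j _ _ → 𝟙-× (n ∣ₚ? i) (i ∣ₚ? j)) (∑-distribˡ N ⟦ n ∣ₚ i ⟧ _)

  sumDivS≡ : ∀ {N n} → 1 ≤ n → n ≤ N →
             sumDivS n ≡ properDivisorCount N n + chainsBelow N n + s n
  sumDivS≡ {N} {n} 1≤n n≤N = begin
    sum (map s (filter (_∣? n) (range n)))      ≡⟨ sum-map-filter (_∣? n) s (range n) ⟩
    sum (map (λ d → 𝟙 (d ∣? n) * s d) (range n)) ≡⟨ sum-map-range n _ ⟩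
    ∑ n (λ d → 𝟙 (d ∣? n) * s d)                 ≡⟨ ∑-truncate _ n≤N nonDivisors ⟨
    ∑ N (λ d → 𝟙 (d ∣? n) * s d)
      ≡⟨ ∑-cong N (λ d 1≤d d≤N → 𝟙-∣-*-split d n (s≡1+properDivisorCount 1≤d d≤N)) ⟩
    ∑ N (λ d → ⟦ d ∣ₚ n ⟧ + ⟦ d ∣ₚ n ⟧ * properDivisorCount N d + 𝟙 (d ≟ n) * s d)
      ≡⟨ ∑-+₃ N _ _ _ ⟩
    properDivisorCount N n + ∑ N (λ d → ⟦ d ∣ₚ n ⟧ * properDivisorCount N d)
      + ∑ N (λ d → 𝟙 (d ≟ n) * s d)
      ≡⟨ cong₂ _+_ (cong (properDivisorCount N n +_) (sym (chainsBelow≡ N n)))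
                   (∑-delta s 1≤n n≤N) ⟩
    properDivisorCount N n + chainsBelow N n + s n ∎
    where
    nonDivisors : ∀ d → n < d → d ≤ N → 𝟙 (d ∣? n) * s d ≡ 0
    nonDivisors d n<d _ = cong (_* s d) (𝟙-no (d ∣? n) λ d∣n → <⇒≱ n<d (∣⇒≤⁺ 1≤n d∣n))

  -- Σ_{n ∣ i ≤ N} ⌊N/i⌋ is evaluated twice: writing i = kn gives Σ_{k ≤ M} ⌊M/k⌋, while
  -- splitting off i = n leaves the proper multiples of n and the chains above n.
  sumFloor≡ : ∀ {N} n → suc n ≤ N →
              sumFloor (N / suc n) ≡ properMultipleCount N (suc n) + chainsAbove N (suc n)
  sumFloor≡ {N} n n<N = +-cancelˡ-≡ M _ _ (begin
    M + sumFloor M                               ≡⟨ ∑-floorDiv M (m≥n⇒m/n>0 n<N) ⟨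
    ∑ M (floorDiv M)                             ≡⟨ ∑-cong M (λ { (suc k) _ _ → floorDiv-/ N n k }) ⟩
    ∑ M (λ k → floorDiv N (k * suc n))           ≡⟨ ∑-multiples n (floorDiv N) N ⟨
    ∑ N (λ i → 𝟙 (suc n ∣? i) * floorDiv N i)
      ≡⟨ ∑-cong N (λ i 1≤i i≤N →
           𝟙-∣-*-split (suc n) i (floorDiv≡1+properMultipleCount 1≤i i≤N)) ⟩
    ∑ N (λ i → ⟦ suc n ∣ₚ i ⟧ + ⟦ suc n ∣ₚ i ⟧ * properMultipleCount N i
               + 𝟙 (suc n ≟ i) * floorDiv N i)
      ≡⟨ ∑-+₃ N _ _ _ ⟩
    properMultipleCount N (suc n) + ∑ N (λ i → ⟦ suc n ∣ₚ i ⟧ * properMultipleCount N i)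
      + ∑ N (λ i → 𝟙 (suc n ≟ i) * floorDiv N i)
      ≡⟨ cong₂ _+_ (cong (properMultipleCount N (suc n) +_) (sym (chainsAbove≡ N (suc n))))
                   (∑-delta-sym (floorDiv N) (s≤s z≤n) n<N) ⟩
    properMultipleCount N (suc n) + chainsAbove N (suc n) + M ≡⟨ +-comm _ M ⟩
    M + (properMultipleCount N (suc n) + chainsAbove N (suc n)) ∎)
    where
    M : ℕ
    M = N / suc n

open TriangleCount
  using ( properDivisorCount; properMultipleCount; chainsBelow; chainsAbove; e≡chains
        ; chainsThrough≡; sumDivS≡; s≡1+properDivisorCount; sumFloor≡; /≡1+properMultipleCount)

open import Data.Nat using (ℕ; suc; _≤_)
import Data.Nat as ℕ
open import Data.Integer using (ℤ; +_; _+_; _-_; _*_)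
open import Data.Integer.Properties using (pos-*)
open import Data.Integer.Solver using (module +-*-Solver)
open import Relation.Binary.PropositionalEquality using (_≡_; refl; trans; cong; module ≡-Reasoning)

countsFormula : ∀ {t σ sₙ F M : ℕ} b d p a →
  t ≡ b ℕ.+ d ℕ.* p ℕ.+ a → σ ≡ d ℕ.+ b ℕ.+ sₙ → sₙ ≡ suc d → F ≡ p ℕ.+ a → M ≡ suc p →
  + t ≡ + σ - + 2 * + sₙ + + 1 + + F + (+ M - + 1) * (+ sₙ - + 2)
countsFormula b d p a refl refl refl refl refl = begin
  + (b ℕ.+ d ℕ.* p ℕ.+ a)   ≡⟨ cong (λ x → + b + x + + a) (pos-* d p) ⟩
  + b + + d * + p + + a     ≡⟨ identity (+ b) (+ d) (+ p) (+ a) ⟩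
  + (d ℕ.+ b ℕ.+ suc d) - + 2 * + suc d + + 1 + + (p ℕ.+ a) + (+ suc p - + 1) * (+ suc d - + 2) ∎
  where
  open ≡-Reasoning
  open +-*-Solver
  identity : ∀ b d p a → b + d * p + a ≡
    d + b + (+ 1 + d) - + 2 * (+ 1 + d) + + 1 + (p + a) + ((+ 1 + p) - + 1) * ((+ 1 + d) - + 2)
  identity = solve 4 (λ b d p a → b :+ d :* p :+ a :=
    d :+ b :+ (con (+ 1) :+ d) :- con (+ 2) :* (con (+ 1) :+ d) :+ con (+ 1) :+ (p :+ a)
      :+ ((con (+ 1) :+ p) :- con (+ 1)) :* ((con (+ 1) :+ d) :- con (+ 2))) refl

theorem2 : (N n : ℕ) → 1 ≤ N → 1 ≤ n → n ≤ N →
    + e N n ≡ + sumDivS n - + 2 * + s n + + 1 + + sumFloor (floorDiv N n)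
              + (+ floorDiv N n - + 1) * (+ s n - + 2)
theorem2 N (suc n) _ 1≤n n<N =
  countsFormula (chainsBelow N (suc n)) (properDivisorCount N (suc n))
                (properMultipleCount N (suc n)) (chainsAbove N (suc n))
    (trans (e≡chains N (suc n) 1≤n)
           (cong (λ c → chainsBelow N (suc n) ℕ.+ c ℕ.+ chainsAbove N (suc n))
                 (chainsThrough≡ N (suc n))))
    (sumDivS≡ 1≤n n<N)
    (s≡1+properDivisorCount 1≤n n<N)
    (sumFloor≡ n n<N)
    (/≡1+properMultipleCount n n<N)
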